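{- Fix two distinct names $a,b$. For PI processes $P,Q$, if $P\sim_g Q$ then $e(P)\sim e(Q)$ in microCCS.
   Context: PI: finite, sum-free $\pi$-calculus, prefixes $\pi::=m(x)\mid\overline m\langle n\rangle$, processes $P::=\mathbf 0\mid\pi.P\mid P_1|P_2\mid(\nu p)P$, up to $\alpha$-conversion, with the convention that bound names are distinct from each other and from free names. Late transitions (labels $a(x)$, $\overline a\langle b\rangle$, $\overline a(p)$, $\tau$): $\pi.P\xrightarrow{\pi}P$; if $P\xrightarrow{a(x)}P'$ and $Q\xrightarrow{\overline a\langle b\rangle}Q'$ then $P|Q\xrightarrow{\tau}P'[b/x]|Q'$; if $P\xrightarrow{\overline a\langle b\rangle}P'$, $a\neq b$, then $(\nu b)P\xrightarrow{\overline a(b)}P'$; if $P\xrightarrow{a(x)}P'$ and $Q\xrightarrow{\overline a(p)}Q'$ then $P|Q\xrightarrow{\tau}(\nu p)(P'[p/x]|Q')$; if $P\xrightarrow{\mu}P'$ with bound names of $\mu$ not free in $Q$ then $P|Q\xrightarrow{\mu}P'|Q$; if $P\xrightarrow{\mu}P'$ with $p$ not free in $\mu$ then $(\nu p)P\xrightarrow{\mu}(\nu p)P'$; plus symmetric parallel rules. Ground bisimilarity $\sim_g$ is the union of symmetric relations $\mathcal R$ with $P\mathcal RQ$, $P\xrightarrow{\mu}P'$ implying $Q\xrightarrow{\mu}Q'$, $P'\mathcal RQ'$. MicroCCS: processes $\eta::=c\mid\overline c$, $P::=\mathbf 0\mid\eta.P\mid P|Q$, transitions $\eta.P\xrightarrow{\eta}P$,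 synchronisation of $\eta$ and $\overline\eta$ into $\tau$ across $|$, and interleaving; $\sim$ is strong bisimilarity. The erasing $e(P)$ (relative to $a,b$) is: $e(P_1|P_2)=e(P_1)|e(P_2)$, $e((\nu p)P)=e(P)$, $e(\mathbf 0)=\mathbf 0$, $e(a(x).P)=a.e(P)$, $e(m(x).P)=\mathbf 0$ if $m\neq a$, $e(\overline b\langle n\rangle.P)=\overline b.e(P)$, $e(\overline m\langle n\rangle.P)=\mathbf 0$ if $m\neq b$. -}

module Defs where

open import Data.Nat using (ℕ; zero; suc; _+_)
open import Data.Nat.Properties using (_≟_)
open import Data.Product using (Σ; ∃; _×_; _,_)
open import Relation.Binary.Core using (Rel)
open import Relation.Binary.Definitions using (Symmetric)
open import Relation.Nullary using (yes; no)
import Level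

-- PI: finite sum-free π-calculus, up to α-conversion.
-- α-conversion is handled by de Bruijn indices: a name is a natural
-- number; index i refers to the i-th enclosing binder, and indices
-- beyond the enclosing binders are the free names.

Name : Set
Name = ℕ

data Proc : Set where
  𝟘   : Proc
  inp : Name → Proc → Proc            -- m(x).P    (x = index 0 in P)
  out : Name → Name → Proc → Proc
  _∣_ : Proc → Proc → Proc
  ν   : Proc → Proc                   -- (νp)P     (p = index 0 in P)

lift : (Name → Name) → Name → Name
lift f zero    = zero
lift f (suc i) = suc (f i)

ren : (Name → Name) → Proc → Proc
ren f 𝟘         = 𝟘
ren f (inp m P) = inp (f m) (ren (lift f) P)
ren f (out m n P) = out (f m) (f n) (ren f P)
ren f (P ∣ Q)   = ren f P ∣ ren f Q
ren f (ν P)     = ν (ren (lift f) P)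

shift : Proc → Proc
shift = ren suc

swap01 : Name → Name
swap01 zero          = suc zero
swap01 (suc zero)    = zero
swap01 (suc (suc i)) = suc (suc i)

swap : Proc → Proc
swap = ren swap01

subst0 : Name → Proc → Proc
subst0 b = ren σ
  where
  σ : Name → Name
  σ zero    = b
  σ (suc i) = i

-- Late action labels.  For the bound labels a(x) and ā(p) the bound
-- name is index 0 of the derivative.
data Act : Set where
  inA  : Name → Act
  outA : Name → Name → Act
  boutA : Name → Act
  τ    : Act

infix 4 _─[_]→_

data _─[_]→_ : Proc → Act → Proc → Set where
  pre-in  : ∀ {m P} → inp m P ─[ inA m ]→ P
  pre-out : ∀ {m n P} → out m n P ─[ outA m n ]→ P
  commL : ∀ {P Q P' Q' a b} → P ─[ inA a ]→ P' → Q ─[ outA a b ]→ Q' →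
          (P ∣ Q) ─[ τ ]→ (subst0 b P' ∣ Q')
  commR : ∀ {P Q P' Q' a b} → P ─[ outA a b ]→ P' → Q ─[ inA a ]→ Q' →
          (P ∣ Q) ─[ τ ]→ (P' ∣ subst0 b Q')
  -- open: P ─ā⟨p⟩→ P', a ≠ p  ⇒  (νp)P ─ā(p)→ P'
  open' : ∀ {P P' a} → P ─[ outA (suc a) zero ]→ P' →
          ν P ─[ boutA a ]→ P'
  closeL : ∀ {P Q P' Q' a} → P ─[ inA a ]→ P' → Q ─[ boutA a ]→ Q' →
           (P ∣ Q) ─[ τ ]→ ν (P' ∣ Q')
  closeR : ∀ {P Q P' Q' a} → P ─[ boutA a ]→ P' → Q ─[ inA a ]→ Q' →
           (P ∣ Q) ─[ τ ]→ ν (P' ∣ Q')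
  -- interleaving (bound name of μ chosen fresh for Q: Q is weakened)
  parL-τ    : ∀ {P P' Q} → P ─[ τ ]→ P' → (P ∣ Q) ─[ τ ]→ (P' ∣ Q)
  parL-out  : ∀ {P P' Q a b} → P ─[ outA a b ]→ P' → (P ∣ Q) ─[ outA a b ]→ (P' ∣ Q)
  parL-in   : ∀ {P P' Q a} → P ─[ inA a ]→ P' → (P ∣ Q) ─[ inA a ]→ (P' ∣ shift Q)
  parL-bout : ∀ {P P' Q a} → P ─[ boutA a ]→ P' → (P ∣ Q) ─[ boutA a ]→ (P' ∣ shift Q)
  parR-τ    : ∀ {P Q Q'} → Q ─[ τ ]→ Q' → (P ∣ Q) ─[ τ ]→ (P ∣ Q')
  parR-out  : ∀ {P Q Q' a b} → Q ─[ outA a b ]→ Q' → (P ∣ Q) ─[ outA a b ]→ (P ∣ Q')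
  parR-in   : ∀ {P Q Q' a} → Q ─[ inA a ]→ Q' → (P ∣ Q) ─[ inA a ]→ (shift P ∣ Q')
  parR-bout : ∀ {P Q Q' a} → Q ─[ boutA a ]→ Q' → (P ∣ Q) ─[ boutA a ]→ (shift P ∣ Q')
  -- restriction, the restricted name (index 0) not free in μ
  res-τ    : ∀ {P P'} → P ─[ τ ]→ P' → ν P ─[ τ ]→ ν P'
  res-out  : ∀ {P P' a b} → P ─[ outA (suc a) (suc b) ]→ P' →
             ν P ─[ outA a b ]→ ν P'
  res-in   : ∀ {P P' a} → P ─[ inA (suc a) ]→ P' →
             ν P ─[ inA a ]→ ν (swap P')
  res-bout : ∀ {P P' a} → P ─[ boutA (suc a) ]→ P' →
             ν P ─[ boutA a ]→ ν (swap P')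

IsGroundBisim : Rel Proc Level.zero → Set
IsGroundBisim R =
  Symmetric R ×
  (∀ {P Q} → R P Q → ∀ {μ P'} → P ─[ μ ]→ P' → ∃ λ Q' → (Q ─[ μ ]→ Q') × R P' Q')

infix 4 _∼g_
_∼g_ : Proc → Proc → Set₁
P ∼g Q = Σ (Rel Proc Level.zero) λ R → IsGroundBisim R × R P Q

Chan : Set
Chan = ℕ

data Pre : Set where
  chan  : Chan → Pre
  cochan : Chan → Pre

co : Pre → Pre
co (chan c)   = cochan c
co (cochan c) = chan c

data CCS : Set where
  𝟘c  : CCS
  _·_ : Pre → CCS → CCS
  _∥_ : CCS → CCS → CCS

data CLab : Set where
  act : Pre → CLab
  τc  : CLab

infix 4 _─c[_]→_

data _─c[_]→_ : CCS → CLab → CCS → Set where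
  pre  : ∀ {η P} → (η · P) ─c[ act η ]→ P
  sync : ∀ {P Q P' Q' η} → P ─c[ act η ]→ P' → Q ─c[ act (co η) ]→ Q' →
         (P ∥ Q) ─c[ τc ]→ (P' ∥ Q')
  parL : ∀ {P P' Q ℓ} → P ─c[ ℓ ]→ P' → (P ∥ Q) ─c[ ℓ ]→ (P' ∥ Q)
  parR : ∀ {P Q Q' ℓ} → Q ─c[ ℓ ]→ Q' → (P ∥ Q) ─c[ ℓ ]→ (P ∥ Q')

IsBisim : Rel CCS Level.zero → Set
IsBisim R =
  Symmetric R ×
  (∀ {P Q} → R P Q → ∀ {ℓ P'} → P ─c[ ℓ ]→ P' → ∃ λ Q' → (Q ─c[ ℓ ]→ Q') × R P' Q')

infix 4 _∼_
_∼_ : CCS → CCS → Set₁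
P ∼ Q = Σ (Rel CCS Level.zero) λ R → IsBisim R × R P Q

-- The erasing e(P) relative to the free names a, b.
-- 'erase' a b k P works under k enclosing binders, where the free
-- names a, b are represented by the indices k + a, k + b.

erase′ : Name → Name → ℕ → Proc → CCS
erase′ a b k 𝟘 = 𝟘c
erase′ a b k (P ∣ Q) = erase′ a b k P ∥ erase′ a b k Q
erase′ a b k (ν P) = erase′ a b (suc k) P
erase′ a b k (inp m P) with m ≟ k + a
... | yes _ = chan a · erase′ a b (suc k) P
... | no  _ = 𝟘c
erase′ a b k (out m n P) with m ≟ k + b
... | yes _ = cochan b · erase′ a b k P
... | no  _ = 𝟘c

e : Name → Name → Proc → CCS
e a b = erase′ a b 0

{-# OPTIONS --safe #-}
module Submission where

-- Erasure keeps exactly the prefixes a(x) and b̄⟨n⟩, and since a ≠ b an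
-- erased process can never synchronise.  So the transitions of e(P) are
-- exactly the images of the inputs of P on a and the free or bound outputs
-- of P on b.  Erasure ignores all other names, hence commutes with the
-- weakenings and name swaps of the π rules, and the erasure of a ground
-- bisimulation (at every binder depth) is a strong bisimulation.

open import Defs
open import Data.Nat using (ℕ; zero; suc; _+_)
open import Data.Nat.Properties using (_≟_; suc-injective; 0≢1+n)
open import Data.Product using (∃; _×_; _,_)
open import Data.Empty using (⊥; ⊥-elim)
open import Function.Bundles using (_⇔_; mk⇔; Equivalence)
open import Level using (0ℓ)
open import Relation.Binary.Core using (Rel)
open import Relation.Binary.PropositionalEquality using (_≡_; _≢_; refl; cong; cong₂; sym)
open import Relation.Nullary using (yes; no)

-- Under j binders the free name c is the index j + c.
MapsFreeNames : (Name → Name) → ℕ → ℕ → Set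
MapsFreeNames f j k = ∀ c m → f m ≡ k + c ⇔ m ≡ j + c

lift-mapsFreeNames : ∀ {f j k} → MapsFreeNames f j k → MapsFreeNames (lift f) (suc j) (suc k)
lift-mapsFreeNames h c zero    = mk⇔ (λ ()) (λ ())
lift-mapsFreeNames h c (suc m) =
  mk⇔ (λ eq → cong suc (Equivalence.to   (h c m) (suc-injective eq)))
      (λ eq → cong suc (Equivalence.from (h c m) (suc-injective eq)))

suc-mapsFreeNames : ∀ k → MapsFreeNames suc k (suc k)
suc-mapsFreeNames k c m = mk⇔ suc-injective (cong suc)

swap01-mapsFreeNames : ∀ k → MapsFreeNames swap01 (suc (suc k)) (suc (suc k))
swap01-mapsFreeNames k c zero          = mk⇔ (λ eq → ⊥-elim (0≢1+n (suc-injective eq))) (λ ())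
swap01-mapsFreeNames k c (suc zero)    = mk⇔ (λ ()) (λ eq → ⊥-elim (0≢1+n (suc-injective eq)))
swap01-mapsFreeNames k c (suc (suc m)) = mk⇔ (λ eq → eq) (λ eq → eq)

module Erasure (a b : Name) where

  erase : ℕ → Proc → CCS
  erase = erase′ a b

  erase-ren : ∀ {f j k} → MapsFreeNames f j k → ∀ P → erase k (ren f P) ≡ erase j P
  erase-ren h 𝟘 = refl
  erase-ren {f} {j} {k} h (inp m P) with f m ≟ k + a | m ≟ j + a
  ... | yes _  | yes _  = cong (chan a ·_) (erase-ren (lift-mapsFreeNames h) P)
  ... | yes eq | no neq = ⊥-elim (neq (Equivalence.to   (h a m) eq))
  ... | no neq | yes eq = ⊥-elim (neq (Equivalence.from (h a m) eq))
  ... | no _   | no _   = refl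
  erase-ren {f} {j} {k} h (out m n P) with f m ≟ k + b | m ≟ j + b
  ... | yes _  | yes _  = cong (cochan b ·_) (erase-ren h P)
  ... | yes eq | no neq = ⊥-elim (neq (Equivalence.to   (h b m) eq))
  ... | no neq | yes eq = ⊥-elim (neq (Equivalence.from (h b m) eq))
  ... | no _   | no _   = refl
  erase-ren h (P ∣ Q) = cong₂ _∥_ (erase-ren h P) (erase-ren h Q)
  erase-ren h (ν P)   = erase-ren (lift-mapsFreeNames h) P

  erase-shift : ∀ k P → erase (suc k) (shift P) ≡ erase k P
  erase-shift k = erase-ren (suc-mapsFreeNames k)

  erase-swap : ∀ k P → erase (suc (suc k)) (swap P) ≡ erase (suc (suc k)) P
  erase-swap k = erase-ren (swap01-mapsFreeNames k)

  erase-input : ∀ {k P P'} → P ─[ inA (k + a) ]→ P' →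
                erase k P ─c[ act (chan a) ]→ erase (suc k) P'
  erase-input {k} {inp m P} pre-in with m ≟ k + a
  ... | yes _  = pre
  ... | no neq = ⊥-elim (neq refl)
  erase-input {k} {P ∣ Q} (parL-in t) rewrite sym (erase-shift k Q) = parL (erase-input t)
  erase-input {k} {P ∣ Q} (parR-in t) rewrite sym (erase-shift k P) = parR (erase-input t)
  erase-input {k} (res-in {P' = P'} t) rewrite erase-swap k P' = erase-input {suc k} t

  erase-output : ∀ {k P P' n} → P ─[ outA (k + b) n ]→ P' →
                 erase k P ─c[ act (cochan b) ]→ erase k P'
  erase-output {k} {out m n P} pre-out with m ≟ k + b
  ... | yes _  = pre
  ... | no neq = ⊥-elim (neq refl)
  erase-output (parL-out t)   = parL (erase-output t)
  erase-output (parR-out t)   = parR (erase-output t)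
  erase-output {k} (res-out t) = erase-output {suc k} t

  erase-boundOutput : ∀ {k P P'} → P ─[ boutA (k + b) ]→ P' →
                      erase k P ─c[ act (cochan b) ]→ erase (suc k) P'
  erase-boundOutput {k} (open' t) = erase-output {suc k} t
  erase-boundOutput {k} {P ∣ Q} (parL-bout t) rewrite sym (erase-shift k Q) =
    parL (erase-boundOutput t)
  erase-boundOutput {k} {P ∣ Q} (parR-bout t) rewrite sym (erase-shift k P) =
    parR (erase-boundOutput t)
  erase-boundOutput {k} (res-bout {P' = P'} t) rewrite erase-swap k P' =
    erase-boundOutput {suc k} t

  data ErasedStep (k : ℕ) (P : Proc) : CLab → CCS → Set where
    input       : ∀ {P'} → P ─[ inA (k + a) ]→ P' →
                  ErasedStep k P (act (chan a)) (erase (suc k) P')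
    output      : ∀ {n P'} → P ─[ outA (k + b) n ]→ P' →
                  ErasedStep k P (act (cochan b)) (erase k P')
    boundOutput : ∀ {P'} → P ─[ boutA (k + b) ]→ P' →
                  ErasedStep k P (act (cochan b)) (erase (suc k) P')

  erasedStep-transition : ∀ {k P ℓ X} → ErasedStep k P ℓ X → erase k P ─c[ ℓ ]→ X
  erasedStep-transition (input t)       = erase-input t
  erasedStep-transition (output t)      = erase-output t
  erasedStep-transition (boundOutput t) = erase-boundOutput t

  module _ (a≢b : a ≢ b) where

    no-complementary-steps : ∀ {k j P Q η X Y} →
      ErasedStep k P (act η) X → ErasedStep j Q (act (co η)) Y → ⊥
    -- In each remaining case the label indices can only unify by identifying a with b.
    no-complementary-steps (input _)       (output _)      = a≢b refl
    no-complementary-steps (input _)       (boundOutput _) = a≢b refl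
    no-complementary-steps (output _)      (input _)       = a≢b refl
    no-complementary-steps (boundOutput _) (input _)       = a≢b refl

    erasedStep : ∀ k P {ℓ X} → erase k P ─c[ ℓ ]→ X → ErasedStep k P ℓ X
    erasedStep k (inp m P) t with m ≟ k + a
    erasedStep k (inp m P) pre | yes refl = input pre-in
    erasedStep k (out m n P) t with m ≟ k + b
    erasedStep k (out m n P) pre | yes refl = output pre-out
    erasedStep k (P ∣ Q) (sync t u) =
      ⊥-elim (no-complementary-steps (erasedStep k P t) (erasedStep k Q u))
    erasedStep k (P ∣ Q) (parL t) with erasedStep k P t
    ... | input s       rewrite sym (erase-shift k Q) = input (parL-in s)
    ... | output s      = output (parL-out s)
    ... | boundOutput s rewrite sym (erase-shift k Q) = boundOutput (parL-bout s)
    erasedStep k (P ∣ Q) (parR t) with erasedStep k Q t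
    ... | input s       rewrite sym (erase-shift k P) = input (parR-in s)
    ... | output s      = output (parR-out s)
    ... | boundOutput s rewrite sym (erase-shift k P) = boundOutput (parR-bout s)
    erasedStep k (ν P) t with erasedStep (suc k) P t
    ... | input {P'} s       rewrite sym (erase-swap k P') = input (res-in s)
    ... | output {zero} s    = boundOutput (open' s)
    ... | output {suc n} s   = output (res-out s)
    ... | boundOutput {P'} s rewrite sym (erase-swap k P') = boundOutput (res-bout s)

    data Erased (S : Rel Proc 0ℓ) : Rel CCS 0ℓ where
      erased : ∀ {k P Q} → S P Q → Erased S (erase k P) (erase k Q)

    erased-isBisim : ∀ {S} → IsGroundBisim S → IsBisim (Erased S)
    erased-isBisim {S} (S-sym , S-step) = Erased-sym , Erased-step
      where
      Erased-sym : ∀ {X Y} → Erased S X Y → Erased S Y X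
      Erased-sym (erased s) = erased (S-sym s)

      simulate : ∀ {k P Q ℓ X'} → S P Q → ErasedStep k P ℓ X' →
                 ∃ λ Y' → ErasedStep k Q ℓ Y' × Erased S X' Y'
      simulate s (input t)       with S-step s t
      ... | _ , u , s' = _ , input u , erased s'
      simulate s (output t)      with S-step s t
      ... | _ , u , s' = _ , output u , erased s'
      simulate s (boundOutput t) with S-step s t
      ... | _ , u , s' = _ , boundOutput u , erased s'

      Erased-step : ∀ {X Y} → Erased S X Y → ∀ {ℓ X'} → X ─c[ ℓ ]→ X' →
                    ∃ λ Y' → (Y ─c[ ℓ ]→ Y') × Erased S X' Y'
      Erased-step (erased {k} {P} s) t with simulate s (erasedStep k P t)
      ... | Y' , u , r = Y' , erasedStep-transition u , r

open Erasure

proposition5p5 : (a b : Name) → a ≢ b → (P Q : Proc) → P ∼g Q → e a b P ∼ e a b Q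
proposition5p5 a b a≢b P Q (S , S-isGroundBisim , PSQ) =
  Erased a b a≢b S , erased-isBisim a b a≢b S-isGroundBisim , erased {k = 0} PSQ
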